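{- Let $G$ be a balanced bipartite graph on $n$ vertices with bipartition $V_1,V_2$ (so $|V_1|=|V_2|$), which has no path of length $k$. Then there exist $X_1\subseteq V_1$ and $X_2\subseteq V_2$ such that $|X_1|=|X_2|\ge (n-k)/4$ and $G$ has no edges between $X_1$ and $X_2$.
   Context: The length of a path is its number of edges. -}

module Defs where

open import Data.Nat using (ℕ; suc)
open import Data.Fin using (Fin; suc; inject₁)
open import Data.Sum using (_⊎_; inj₁; inj₂)
open import Data.Empty using (⊥)
open import Data.Vec using (Vec; lookup)
open import Data.Product using (Σ; _×_)
open import Function.Definitions using (Injective)
open import Relation.Binary.PropositionalEquality using (_≡_)

-- A balanced bipartite graph with parts V₁ = Fin m and V₂ = Fin m
-- (so n = m + m vertices) is given by its edge relation E a b,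
-- meaning: a ∈ V₁ is adjacent to b ∈ V₂. No edges inside a part.

Vertex : ℕ → Set
Vertex m = Fin m ⊎ Fin m

Adj : {m : ℕ} → (Fin m → Fin m → Set) → Vertex m → Vertex m → Set
Adj E (inj₁ a) (inj₂ b) = E a b
Adj E (inj₂ b) (inj₁ a) = E a b
Adj E (inj₁ _) (inj₁ _) = ⊥
Adj E (inj₂ _) (inj₂ _) = ⊥

IsPath : {m : ℕ} → (Fin m → Fin m → Set) → (k : ℕ) → Vec (Vertex m) (suc k) → Set
IsPath E k vs =
  Injective _≡_ _≡_ (lookup vs) ×
  ((i : Fin k) → Adj E (lookup vs (inject₁ i)) (lookup vs (suc i)))

HasPathOfLength : {m : ℕ} → (Fin m → Fin m → Set) → ℕ → Set
HasPathOfLength E k = Σ (Vec (Vertex _) (suc k)) (IsPath E k)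

-- Depth-first search, as in Ben-Eliezer, Krivelevich and Sudakov. Each part is split into processed
-- vertices S, vertices on the stack U and unvisited vertices T, and there is never an edge between S
-- and the unvisited vertices of the opposite part. The top of the stack is extended by an unvisited
-- neighbour if it has one and is moved to S otherwise; each step lowers 2|T| + |U|. The stack is a
-- path, so it has at most k vertices, alternating between the parts. Hence, with s = ⌈(2m − k)/4⌉,
-- as soon as S reaches s vertices in one part, the opposite part has fewer than s processed and at
-- most k/2 stacked vertices, so at least m − s − k/2 ≥ s unvisited ones: s of each give the pair.
module Submission where

open import Defs
open import Data.Nat using (ℕ; zero; suc; _+_; _*_; _∸_; _≥_; _≤_; _<_; z≤n; s≤s; s≤s⁻¹; z<s)
open import Data.Nat.Properties hiding (suc-injective)
open import Data.Nat.Induction using (<-wellFounded)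
open import Data.Nat.Tactic.RingSolver using (solve-∀)
open import Data.Fin using (Fin; zero; suc; inject₁)
open import Data.Fin.Properties using (any?; suc-injective)
open import Data.Fin.Subset using (Subset; inside; outside; ⊥; ∁; _∪_; _∈_; _∉_; _⊆_; ⁅_⁆; ∣_∣; Nonempty)
open import Data.Fin.Subset.Properties
  using (_∈?_; ∉⊥; ⊥⊆; ∣⊥∣≡0; ∣⁅x⁆∣≡1; ∣p∣≤n; ∣p∣≤∣x∷p∣; ∣∁p∣≡n∸∣p∣; x∈⁅x⁆; x∈⁅y⁆⇒x≡y;
         x∈p∪q⁺; x∈p∪q⁻; q⊆p∪q; ∪-assoc; ∪-comm; ∪-identityˡ; p⊆q⇒∁p⊇∁q; p⊂q⇒∁p⊃∁q;
         p⊆q⇒∣p∣≤∣q∣; p⊂q⇒∣p∣<∣q∣; x∈∁p⇒x∉p; nonempty?; Empty-unique; out⊆; s⊆s)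
open import Data.Sum using (_⊎_; inj₁; inj₂)
open import Data.Vec using (Vec; []; _∷_; lookup)
open import Data.Vec.Membership.Propositional using () renaming (_∈_ to _∈ᵥ_; _∉_ to _∉ᵥ_)
open import Data.Vec.Membership.Propositional.Properties using (∈-lookup)
open import Data.Vec.Relation.Unary.Any using (here; there)
open import Data.Product using (Σ; ∃-syntax; _×_; _,_; proj₁)
open import Data.Unit using (⊤; tt)
open import Data.Empty using (⊥-elim)
open import Function.Definitions using (Injective)
open import Induction.WellFounded using (Acc; acc)
open import Relation.Nullary using (¬_; Dec; yes; no; contradiction)
open import Relation.Nullary.Decidable using (_×-dec_)
open import Relation.Binary using (Decidable)
open import Relation.Binary.PropositionalEquality using (_≡_; refl; sym; trans; cong; subst)

∣p∪q∣≤∣p∣+∣q∣ : ∀ {n} (p q : Subset n) → ∣ p ∪ q ∣ ≤ ∣ p ∣ + ∣ q ∣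
∣p∪q∣≤∣p∣+∣q∣ []            []            = z≤n
∣p∪q∣≤∣p∣+∣q∣ (inside  ∷ p) (y ∷ q)       =
  s≤s (≤-trans (∣p∪q∣≤∣p∣+∣q∣ p q) (+-monoʳ-≤ ∣ p ∣ (∣p∣≤∣x∷p∣ y q)))
∣p∪q∣≤∣p∣+∣q∣ (outside ∷ p) (inside  ∷ q) =
  ≤-trans (s≤s (∣p∪q∣≤∣p∣+∣q∣ p q)) (≤-reflexive (sym (+-suc ∣ p ∣ ∣ q ∣)))
∣p∪q∣≤∣p∣+∣q∣ (outside ∷ p) (outside ∷ q) = ∣p∪q∣≤∣p∣+∣q∣ p q

n≤∣∁[p∪q]∣+∣p∣+∣q∣ : ∀ {n} (p q : Subset n) → n ≤ ∣ ∁ (p ∪ q) ∣ + ∣ p ∣ + ∣ q ∣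
n≤∣∁[p∪q]∣+∣p∣+∣q∣ {n} p q = begin
  n                            ≡⟨ sym (m∸n+n≡m (∣p∣≤n (p ∪ q))) ⟩
  n ∸ ∣ p ∪ q ∣ + ∣ p ∪ q ∣    ≡⟨ cong (_+ ∣ p ∪ q ∣) (sym (∣∁p∣≡n∸∣p∣ (p ∪ q))) ⟩
  ∣ ∁ (p ∪ q) ∣ + ∣ p ∪ q ∣    ≤⟨ +-monoʳ-≤ ∣ ∁ (p ∪ q) ∣ (∣p∪q∣≤∣p∣+∣q∣ p q) ⟩
  ∣ ∁ (p ∪ q) ∣ + (∣ p ∣ + ∣ q ∣)  ≡⟨ sym (+-assoc (∣ ∁ (p ∪ q) ∣) ∣ p ∣ ∣ q ∣) ⟩
  ∣ ∁ (p ∪ q) ∣ + ∣ p ∣ + ∣ q ∣    ∎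
  where open ≤-Reasoning

∣p∣>0⇒Nonempty : ∀ {n} (p : Subset n) → 0 < ∣ p ∣ → Nonempty p
∣p∣>0⇒Nonempty {n} p 0<∣p∣ with nonempty? p
... | yes nonempty = nonempty
... | no  empty    = contradiction (trans (cong ∣_∣ (Empty-unique empty)) (∣⊥∣≡0 n)) (>⇒≢ 0<∣p∣)

p∪[q∪r]≡q∪[p∪r] : ∀ {n} (p q r : Subset n) → p ∪ (q ∪ r) ≡ q ∪ (p ∪ r)
p∪[q∪r]≡q∪[p∪r] p q r = begin
  p ∪ (q ∪ r)  ≡⟨ sym (∪-assoc p q r) ⟩
  (p ∪ q) ∪ r  ≡⟨ cong (_∪ r) (∪-comm p q) ⟩
  (q ∪ p) ∪ r  ≡⟨ ∪-assoc q p r ⟩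
  q ∪ (p ∪ r)  ∎
  where open Relation.Binary.PropositionalEquality.≡-Reasoning

shrink : ∀ {n} s (p : Subset n) → s ≤ ∣ p ∣ → Σ (Subset n) λ q → q ⊆ p × ∣ q ∣ ≡ s
shrink {n} zero p _ = ⊥ , ⊥⊆ , ∣⊥∣≡0 n
shrink (suc s) (inside ∷ p) s<∣p∣ with shrink s p (s≤s⁻¹ s<∣p∣)
... | q , q⊆p , ∣q∣≡s = inside ∷ q , s⊆s q⊆p , cong suc ∣q∣≡s
shrink (suc s) (outside ∷ p) s<∣p∣ with shrink (suc s) p s<∣p∣
... | q , q⊆p , ∣q∣≡s = outside ∷ q , out⊆ q⊆p , ∣q∣≡s

twice-suc : ∀ {c n} → 2 * c ≤ n → 2 * suc c ≤ suc (suc n)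
twice-suc {c} 2c≤n = ≤-trans (≤-reflexive (*-suc 2 c)) (s≤s (s≤s 2c≤n))

2a+1+n<2b+n : ∀ {a b} n → a < b → 2 * a + suc n < 2 * b + n
2a+1+n<2b+n {a} {b} n a<b = begin-strict
  2 * a + suc n          ≡⟨ +-suc (2 * a) n ⟩
  suc (2 * a + n)        <⟨ n<1+n _ ⟩
  suc (suc (2 * a + n))  ≡⟨ cong (_+ n) (sym (*-suc 2 a)) ⟩
  2 * suc a + n          ≤⟨ +-monoˡ-≤ n (*-monoʳ-≤ 2 a<b) ⟩
  2 * b + n              ∎
  where open ≤-Reasoning

-- Doubling the first hypothesis gives 2m ≤ 2t + 2c + k, so t < s would force 4s + k ≥ 2m + 4.
side-bound : ∀ {m t c u k s} → m ≤ t + c + u → c < s → 2 * u ≤ k → 4 * s + k ≤ m + m + 3 → s ≤ t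
side-bound {m} {t} {c} {u} {k} {s} m≤t+c+u c<s 2u≤k room = ≮⇒≥ λ t<s → <-irrefl refl (begin-strict
  m + m + 3                      ≤⟨ +-monoˡ-≤ 3 (+-mono-≤ m≤t+c+u m≤t+c+u) ⟩
  (t + c + u) + (t + c + u) + 3  ≡⟨ regroup t c u ⟩
  2 * u + (t + c + (t + c) + 3)  <⟨ +-mono-≤-< 2u≤k (below t<s) ⟩
  k + 4 * s                      ≡⟨ +-comm k (4 * s) ⟩
  4 * s + k                      ≤⟨ room ⟩
  m + m + 3                      ∎)
  where
  open ≤-Reasoning
  regroup : ∀ t c u → (t + c + u) + (t + c + u) + 3 ≡ 2 * u + (t + c + (t + c) + 3)
  regroup = solve-∀
  shift : ∀ t c → suc (t + c + (t + c) + 3) ≡ suc t + suc c + (suc t + suc c)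
  shift = solve-∀
  four : ∀ s → s + s + (s + s) ≡ 4 * s
  four = solve-∀
  below : t < s → t + c + (t + c) + 3 < 4 * s
  below t<s = begin-strict
    t + c + (t + c) + 3              <⟨ n<1+n _ ⟩
    suc (t + c + (t + c) + 3)        ≡⟨ shift t c ⟩
    suc t + suc c + (suc t + suc c)  ≤⟨ +-mono-≤ (+-mono-≤ t<s c<s) (+-mono-≤ t<s c<s) ⟩
    s + s + (s + s)                  ≡⟨ four s ⟩
    4 * s                            ∎

quarter : ∀ d → ∃[ s ] d ≤ 4 * s × 4 * s ≤ d + 3
quarter zero = 0 , z≤n , z≤n
quarter (suc d) with quarter d
... | s , d≤4s , 4s≤d+3 with m≤n⇒m<n∨m≡n d≤4s
...   | inj₁ d<4s = s , d<4s , m≤n⇒m≤1+n 4s≤d+3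
...   | inj₂ refl =
  suc s , ≤-trans (m≤m+n (suc (4 * s)) 3) (≤-reflexive (sym (4[1+s] s))) , ≤-reflexive (4[1+s] s)
  where
  4[1+s] : ∀ s → 4 * suc s ≡ suc (4 * s) + 3
  4[1+s] = solve-∀

fitting-size : ∀ {k n} → k ≤ n → ∃[ s ] n ≤ 4 * s + k × 4 * s + k ≤ n + 3
fitting-size {k} {n} k≤n with quarter (n ∸ k)
... | s , d≤4s , 4s≤d+3 = s , lower , upper
  where
  open ≤-Reasoning
  swap-3 : ∀ d k → d + 3 + k ≡ d + k + 3
  swap-3 = solve-∀
  lower : n ≤ 4 * s + k
  lower = begin
    n          ≡⟨ sym (m∸n+n≡m k≤n) ⟩
    n ∸ k + k  ≤⟨ +-monoˡ-≤ k d≤4s ⟩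
    4 * s + k  ∎
  upper : 4 * s + k ≤ n + 3
  upper = begin
    4 * s + k      ≤⟨ +-monoˡ-≤ k 4s≤d+3 ⟩
    n ∸ k + 3 + k  ≡⟨ swap-3 (n ∸ k) k ⟩
    n ∸ k + k + 3  ≡⟨ cong (_+ 3) (m∸n+n≡m k≤n) ⟩
    n + 3          ∎

data Part : Set where
  V₁ V₂ : Part

opposite : Part → Part
opposite V₁ = V₂
opposite V₂ = V₁

module _ {m : ℕ} where

  vertex : Part → Fin m → Vertex m
  vertex V₁ = inj₁
  vertex V₂ = inj₂

  Edge : (Fin m → Fin m → Set) → Part → Fin m → Fin m → Set
  Edge E V₁ i j = E i j
  Edge E V₂ i j = E j i

  edge? : {E : Fin m → Fin m → Set} → Decidable E → ∀ P → Decidable (Edge E P)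
  edge? E? V₁ i j = E? i j
  edge? E? V₂ i j = E? j i

  Edge⇒Adj : ∀ {E} P {i j} → Edge E P i j → Adj E (vertex (opposite P) j) (vertex P i)
  Edge⇒Adj V₁ e = e
  Edge⇒Adj V₂ e = e

  vertex-injective : ∀ {P Q} {i j : Fin m} → vertex P i ≡ vertex Q j → P ≡ Q × i ≡ j
  vertex-injective {V₁} {V₁} refl = refl , refl
  vertex-injective {V₂} {V₂} refl = refl , refl
  vertex-injective {V₁} {V₂} ()
  vertex-injective {V₂} {V₁} ()

  vertexIn : Part → Vertex m → Subset m
  vertexIn V₁ (inj₁ a) = ⁅ a ⁆
  vertexIn V₁ (inj₂ _) = ⊥
  vertexIn V₂ (inj₁ _) = ⊥
  vertexIn V₂ (inj₂ b) = ⁅ b ⁆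

  pathIn : ∀ {n} → Part → Vec (Vertex m) n → Subset m
  pathIn P []       = ⊥
  pathIn P (x ∷ vs) = vertexIn P x ∪ pathIn P vs

  count : ∀ {n} → Part → Vec (Vertex m) n → ℕ
  count P  []            = 0
  count V₁ (inj₁ _ ∷ vs) = suc (count V₁ vs)
  count V₁ (inj₂ _ ∷ vs) = count V₁ vs
  count V₂ (inj₁ _ ∷ vs) = count V₂ vs
  count V₂ (inj₂ _ ∷ vs) = suc (count V₂ vs)

  vertexIn-vertex : ∀ P i → i ∈ vertexIn P (vertex P i)
  vertexIn-vertex V₁ i = x∈⁅x⁆ i
  vertexIn-vertex V₂ i = x∈⁅x⁆ i

  vertexIn-sound : ∀ P {i} x → i ∈ vertexIn P x → vertex P i ≡ x
  vertexIn-sound V₁ (inj₁ a) i∈a = cong inj₁ (x∈⁅y⁆⇒x≡y a i∈a)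
  vertexIn-sound V₂ (inj₂ b) i∈b = cong inj₂ (x∈⁅y⁆⇒x≡y b i∈b)
  vertexIn-sound V₁ (inj₂ _) i∈⊥ = contradiction i∈⊥ ∉⊥
  vertexIn-sound V₂ (inj₁ _) i∈⊥ = contradiction i∈⊥ ∉⊥

  same-part⊎vertexIn≡⊥ : ∀ P Q (i : Fin m) → P ≡ Q ⊎ vertexIn Q (vertex P i) ≡ ⊥
  same-part⊎vertexIn≡⊥ V₁ V₁ i = inj₁ refl
  same-part⊎vertexIn≡⊥ V₂ V₂ i = inj₁ refl
  same-part⊎vertexIn≡⊥ V₁ V₂ i = inj₂ refl
  same-part⊎vertexIn≡⊥ V₂ V₁ i = inj₂ refl

  pathIn-complete : ∀ P {i n} {vs : Vec (Vertex m) n} → vertex P i ∈ᵥ vs → i ∈ pathIn P vs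
  pathIn-complete P {i} (here refl) = x∈p∪q⁺ (inj₁ (vertexIn-vertex P i))
  pathIn-complete P (there v∈vs)    = x∈p∪q⁺ (inj₂ (pathIn-complete P v∈vs))

  ∣pathIn∣≤count : ∀ P {n} (vs : Vec (Vertex m) n) → ∣ pathIn P vs ∣ ≤ count P vs
  ∣pathIn∣≤count P []       = ≤-reflexive (∣⊥∣≡0 m)
  ∣pathIn∣≤count P (x ∷ vs) =
    ≤-trans (∣p∪q∣≤∣p∣+∣q∣ (vertexIn P x) (pathIn P vs))
            (≤-trans (+-monoʳ-≤ ∣ vertexIn P x ∣ (∣pathIn∣≤count P vs)) (head-count P x))
    where
    head-count : ∀ P x → ∣ vertexIn P x ∣ + count P vs ≤ count P (x ∷ vs)
    head-count V₁ (inj₁ a) = ≤-reflexive (cong (_+ count V₁ vs) (∣⁅x⁆∣≡1 a))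
    head-count V₂ (inj₂ b) = ≤-reflexive (cong (_+ count V₂ vs) (∣⁅x⁆∣≡1 b))
    head-count V₁ (inj₂ _) = ≤-reflexive (cong (_+ count V₁ vs) (∣⊥∣≡0 m))
    head-count V₂ (inj₁ _) = ≤-reflexive (cong (_+ count V₂ vs) (∣⊥∣≡0 m))

  total : (Part → Subset m) → ℕ
  total f = ∣ f V₁ ∣ + ∣ f V₂ ∣

  total-< : ∀ {f g : Part → Subset m} P → (∀ Q → f Q ⊆ g Q) → ∣ f P ∣ < ∣ g P ∣ → total f < total g
  total-< V₁ f⊆g f<g = +-mono-<-≤ f<g (p⊆q⇒∣p∣≤∣q∣ (f⊆g V₂))
  total-< V₂ f⊆g f<g = +-mono-≤-< (p⊆q⇒∣p∣≤∣q∣ (f⊆g V₁)) f<g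

lookup-∷-injective : ∀ {A : Set} {n} {a : A} {vs : Vec A n} → a ∉ᵥ vs →
  Injective _≡_ _≡_ (lookup vs) → Injective _≡_ _≡_ (lookup (a ∷ vs))
lookup-∷-injective a∉vs inj {zero}  {zero}  _  = refl
lookup-∷-injective {vs = vs} a∉vs inj {zero}  {suc j} a≡ =
  contradiction (subst (_∈ᵥ vs) (sym a≡) (∈-lookup j vs)) a∉vs
lookup-∷-injective {vs = vs} a∉vs inj {suc i} {zero}  ≡a =
  contradiction (subst (_∈ᵥ vs) ≡a (∈-lookup i vs)) a∉vs
lookup-∷-injective a∉vs inj {suc i} {suc j} eq = cong suc (inj eq)

module _ {m : ℕ} (E : Fin m → Fin m → Set) where

  IsStack : ∀ {n} → Vec (Vertex m) n → Set
  IsStack []       = ⊤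
  IsStack (x ∷ vs) = IsPath E _ (x ∷ vs)

  Extends : ∀ {n} → Vertex m → Vec (Vertex m) n → Set
  Extends x []      = ⊤
  Extends x (y ∷ _) = Adj E x y

  IsPath-∷ : ∀ {n x} {vs : Vec (Vertex m) n} → IsStack vs → x ∉ᵥ vs → Extends x vs → IsPath E n (x ∷ vs)
  IsPath-∷ {vs = []} _ x∉vs _ = lookup-∷-injective x∉vs (λ { {()} }) , λ ()
  IsPath-∷ {n = suc n} {x} {vs = y ∷ ws} (inj , adj) x∉vs x~y = lookup-∷-injective x∉vs inj , adjacent
    where
    adjacent : (i : Fin (suc n)) → Adj E (lookup (x ∷ y ∷ ws) (inject₁ i)) (lookup (x ∷ y ∷ ws) (suc i))
    adjacent zero    = x~y
    adjacent (suc i) = adj i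

  IsStack-tail : ∀ {n x} {vs : Vec (Vertex m) n} → IsPath E n (x ∷ vs) → IsStack vs
  IsStack-tail {vs = []}    _           = tt
  IsStack-tail {vs = _ ∷ _} (inj , adj) = (λ eq → suc-injective (inj eq)) , λ i → adj (suc i)

  alternation : ∀ P i {n} (vs : Vec (Vertex m) n) → IsPath E n (vertex P i ∷ vs) →
    2 * count (opposite P) (vertex P i ∷ vs) ≤ suc n × 2 * count P (vertex P i ∷ vs) ≤ suc (suc n)
  alternation V₁ i [] _ = z≤n , ≤-refl
  alternation V₂ i [] _ = z≤n , ≤-refl
  alternation V₁ i (inj₂ j ∷ ws) path with alternation V₂ j ws (IsStack-tail path)
  ... | bound₁ , bound₂ = bound₂ , twice-suc bound₁
  alternation V₂ i (inj₁ j ∷ ws) path with alternation V₁ j ws (IsStack-tail path)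
  ... | bound₂ , bound₁ = bound₁ , twice-suc bound₂
  alternation V₁ i (inj₁ _ ∷ _) (_ , adj) = ⊥-elim (adj zero)
  alternation V₂ i (inj₂ _ ∷ _) (_ , adj) = ⊥-elim (adj zero)

EdgelessPair : ∀ {m} → (Fin m → Fin m → Set) → ℕ → Set
EdgelessPair {m} E s = Σ (Subset m) λ X₁ → Σ (Subset m) λ X₂ →
  ∣ X₁ ∣ ≡ s × ∣ X₂ ∣ ≡ s × ((a b : Fin m) → a ∈ X₁ → b ∈ X₂ → ¬ E a b)

empty-edgelessPair : ∀ {m} {E : Fin m → Fin m → Set} → EdgelessPair E 0
empty-edgelessPair {m} = ⊥ , ⊥ , ∣⊥∣≡0 m , ∣⊥∣≡0 m , λ _ _ a∈⊥ _ _ → ∉⊥ a∈⊥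

shrink-edgelessPair : ∀ {m E s} P {X Y : Subset m} → s ≤ ∣ X ∣ → s ≤ ∣ Y ∣ →
  (∀ i j → i ∈ X → j ∈ Y → ¬ Edge E P i j) → EdgelessPair E s
shrink-edgelessPair {s = s} P {X} {Y} s≤∣X∣ s≤∣Y∣ no-edge
  with shrink s X s≤∣X∣ | shrink s Y s≤∣Y∣
... | X′ , X′⊆X , ∣X′∣≡s | Y′ , Y′⊆Y , ∣Y′∣≡s = orient P no-edge
  where
  orient : ∀ P → (∀ i j → i ∈ X → j ∈ Y → ¬ Edge _ P i j) → EdgelessPair _ s
  orient V₁ no-edge = X′ , Y′ , ∣X′∣≡s , ∣Y′∣≡s , λ a b a∈X′ b∈Y′ → no-edge a b (X′⊆X a∈X′) (Y′⊆Y b∈Y′)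
  orient V₂ no-edge = Y′ , X′ , ∣Y′∣≡s , ∣X′∣≡s , λ a b a∈Y′ b∈X′ → no-edge b a (X′⊆X b∈X′) (Y′⊆Y a∈Y′)

module DepthFirstSearch {m k s : ℕ} {E : Fin m → Fin m → Set} (E? : Decidable E)
  (no-path : ¬ HasPathOfLength E k) (room : 4 * s + k ≤ m + m + 3) where

  Processed : Set
  Processed = Part → Subset m

  occupied : ∀ {n} → Processed → Vec (Vertex m) n → Part → Subset m
  occupied S vs P = S P ∪ pathIn P vs

  unvisited : ∀ {n} → Processed → Vec (Vertex m) n → Part → Subset m
  unvisited S vs P = ∁ (occupied S vs P)

  record Invariant (S : Processed) {n} (vs : Vec (Vertex m) n) : Set where
    field
      stack-path         : IsStack E vs
      height≤k           : n ≤ k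
      processed-small    : ∀ P → ∣ S P ∣ < s
      processed-isolated : ∀ P i j → i ∈ S P → j ∈ unvisited S vs (opposite P) → ¬ Edge E P i j

  record State : Set where
    constructor state
    field
      processed : Processed
      {height}  : ℕ
      stack     : Vec (Vertex m) height
      invariant : Invariant processed stack

  -- A push moves a vertex from T to the stack (−2 + 1), a pop moves one from the stack to S (−1).
  potential : State → ℕ
  potential (state S {n} vs _) = 2 * total (unvisited S vs) + n

  Step : ℕ → Set
  Step p = EdgelessPair E s ⊎ Σ State λ st → potential st < p

  unvisited-large : ∀ S {n} (vs : Vec (Vertex m) n) → Invariant S vs →
    ∀ P → 2 * count P vs ≤ k → s ≤ ∣ unvisited S vs P ∣
  unvisited-large S vs inv P 2c≤k =
    side-bound covering (Invariant.processed-small inv P) 2c≤k room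
    where
    covering : m ≤ ∣ unvisited S vs P ∣ + ∣ S P ∣ + count P vs
    covering = ≤-trans (n≤∣∁[p∪q]∣+∣p∣+∣q∣ (S P) (pathIn P vs))
                      (+-monoʳ-≤ (∣ unvisited S vs P ∣ + ∣ S P ∣) (∣pathIn∣≤count P vs))

  push : ∀ S {n} (vs : Vec (Vertex m) n) (inv : Invariant S vs) P j →
    j ∈ unvisited S vs P → Extends E (vertex P j) vs → Step (potential (state S vs inv))
  push S {n} vs inv P j j-unvisited x~vs = inj₂ (state S (x ∷ vs) inv′ , decreases)
    where
    open Invariant inv
    x = vertex P j
    j-unoccupied : j ∉ occupied S vs P
    j-unoccupied = x∈∁p⇒x∉p j-unvisited
    path : IsPath E n (x ∷ vs)
    path = IsPath-∷ E stack-path (λ x∈vs → j-unoccupied (x∈p∪q⁺ (inj₂ (pathIn-complete P x∈vs)))) x~vs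
    occupied-∷ : ∀ Q → occupied S (x ∷ vs) Q ≡ vertexIn Q x ∪ occupied S vs Q
    occupied-∷ Q = p∪[q∪r]≡q∪[p∪r] (S Q) (vertexIn Q x) (pathIn Q vs)
    occupied-grows : ∀ Q → occupied S vs Q ⊆ occupied S (x ∷ vs) Q
    occupied-grows Q rewrite occupied-∷ Q = q⊆p∪q (vertexIn Q x) (occupied S vs Q)
    unvisited-shrinks : ∀ Q → unvisited S (x ∷ vs) Q ⊆ unvisited S vs Q
    unvisited-shrinks Q = p⊆q⇒∁p⊇∁q (occupied-grows Q)
    inv′ : Invariant S (x ∷ vs)
    inv′ = record
      { stack-path         = path
      ; height≤k           = ≤∧≢⇒< height≤k λ { refl → no-path (x ∷ vs , path) }
      ; processed-small    = processed-small
      ; processed-isolated = λ Q i j′ i∈S j′-unvisited →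
          processed-isolated Q i j′ i∈S (unvisited-shrinks (opposite Q) j′-unvisited)
      }
    j-occupied : j ∈ occupied S (x ∷ vs) P
    j-occupied = x∈p∪q⁺ (inj₂ (x∈p∪q⁺ (inj₁ (vertexIn-vertex P j))))
    decreases : 2 * total (unvisited S (x ∷ vs)) + suc n < 2 * total (unvisited S vs) + n
    decreases = 2a+1+n<2b+n n (total-< P unvisited-shrinks
      (p⊂q⇒∣p∣<∣q∣ (p⊂q⇒∁p⊃∁q (occupied-grows P , j , j-occupied , j-unoccupied))))

  pop : ∀ S P i {n} (vs : Vec (Vertex m) n) (inv : Invariant S (vertex P i ∷ vs)) →
    (∀ j → j ∈ unvisited S (vertex P i ∷ vs) (opposite P) → ¬ Edge E P i j) →
    Step (potential (state S (vertex P i ∷ vs) inv))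
  pop S P i {n} vs inv dead-end = finish (∣ S′ P ∣ <? s)
    where
    open Invariant inv
    x = vertex P i
    S′ : Processed
    S′ Q = vertexIn Q x ∪ S Q
    unvisited-pop : ∀ Q → unvisited S′ vs Q ≡ unvisited S (x ∷ vs) Q
    unvisited-pop Q = cong ∁ (trans (∪-assoc (vertexIn Q x) (S Q) (pathIn Q vs))
                                    (p∪[q∪r]≡q∪[p∪r] (vertexIn Q x) (S Q) (pathIn Q vs)))
    S′-isolated : ∀ Q i′ j → i′ ∈ S′ Q → j ∈ unvisited S (x ∷ vs) (opposite Q) → ¬ Edge E Q i′ j
    S′-isolated Q i′ j i′∈S′ j-unvisited with x∈p∪q⁻ (vertexIn Q x) (S Q) i′∈S′
    ... | inj₂ i′∈S = processed-isolated Q i′ j i′∈S j-unvisited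
    ... | inj₁ i′∈x with vertex-injective (vertexIn-sound Q x i′∈x)
    ...   | refl , refl = dead-end j j-unvisited
    S′-small : ∣ S′ P ∣ < s → ∀ Q → ∣ S′ Q ∣ < s
    S′-small small Q with same-part⊎vertexIn≡⊥ P Q i
    ... | inj₁ refl = small
    ... | inj₂ x∉Q rewrite x∉Q | ∪-identityˡ (S Q) = processed-small Q
    inv′ : ∣ S′ P ∣ < s → Invariant S′ vs
    inv′ small = record
      { stack-path         = IsStack-tail E stack-path
      ; height≤k           = ≤-trans (n≤1+n n) height≤k
      ; processed-small    = S′-small small
      ; processed-isolated = λ Q i′ j i′∈S′ j-unvisited →
          S′-isolated Q i′ j i′∈S′ (subst (j ∈_) (unvisited-pop (opposite Q)) j-unvisited)
      }
    decreases : 2 * total (unvisited S′ vs) + n < 2 * total (unvisited S (x ∷ vs)) + suc n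
    decreases rewrite unvisited-pop V₁ | unvisited-pop V₂ = +-monoʳ-< _ (n<1+n n)
    opposite-large : s ≤ ∣ unvisited S (x ∷ vs) (opposite P) ∣
    opposite-large = unvisited-large S (x ∷ vs) inv (opposite P)
      (≤-trans (proj₁ (alternation E P i vs stack-path)) height≤k)
    finish : Dec (∣ S′ P ∣ < s) → Step (potential (state S (x ∷ vs) inv))
    finish (no ¬small) = inj₁ (shrink-edgelessPair P (≮⇒≥ ¬small) opposite-large (S′-isolated P))
    finish (yes small) = inj₂ (state S′ vs (inv′ small) , decreases)

  explore : ∀ S P i {n} (vs : Vec (Vertex m) n) (inv : Invariant S (vertex P i ∷ vs)) →
    Step (potential (state S (vertex P i ∷ vs) inv))
  explore S P i vs inv
    with any? (λ j → (j ∈? unvisited S (vertex P i ∷ vs) (opposite P)) ×-dec edge? E? P i j)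
  ... | yes (j , j-unvisited , e) = push S (vertex P i ∷ vs) inv (opposite P) j j-unvisited (Edge⇒Adj P e)
  ... | no dead-end = pop S P i vs inv λ j j-unvisited e → dead-end (j , j-unvisited , e)

  step : (st : State) → Step (potential st)
  step (state S [] inv)
    with ∣p∣>0⇒Nonempty (unvisited S [] V₁) (≤-trans 0<s (unvisited-large S [] inv V₁ z≤n))
    where
    0<s : 0 < s
    0<s = ≤-trans (s≤s z≤n) (Invariant.processed-small inv V₁)
  ... | i , i-unvisited = push S [] inv V₁ i i-unvisited tt
  step (state S (inj₁ i ∷ vs) inv) = explore S V₁ i vs inv
  step (state S (inj₂ j ∷ vs) inv) = explore S V₂ j vs inv

  run : (st : State) → Acc _<_ (potential st) → EdgelessPair E s
  run st (acc smaller) with step st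
  ... | inj₁ pair           = pair
  ... | inj₂ (st′ , st′<st) = run st′ (smaller st′<st)

  initial : 0 < s → State
  initial 0<s = state (λ _ → ⊥) [] record
    { stack-path         = tt
    ; height≤k           = z≤n
    ; processed-small    = λ _ → subst (_< s) (sym (∣⊥∣≡0 m)) 0<s
    ; processed-isolated = λ _ _ _ i∈⊥ _ _ → ∉⊥ i∈⊥
    }

no-path⇒edgelessPair : ∀ {m k s} {E : Fin m → Fin m → Set} → Decidable E →
  ¬ HasPathOfLength E k → 4 * s + k ≤ m + m + 3 → EdgelessPair E s
no-path⇒edgelessPair {s = zero}         _  _       _    = empty-edgelessPair
no-path⇒edgelessPair {s = s@(suc _)} E? no-path room = run (initial z<s) (<-wellFounded _)
  where open DepthFirstSearch {s = s} E? no-path room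

no-path⇒large-edgelessPair : ∀ {m k} {E : Fin m → Fin m → Set} → Decidable E →
  ¬ HasPathOfLength E k → ∃[ s ] m + m ≤ 4 * s + k × EdgelessPair E s
no-path⇒large-edgelessPair {m} {k} E? no-path with ≤-total k (m + m)
... | inj₂ 2m≤k = 0 , 2m≤k , empty-edgelessPair
... | inj₁ k≤2m with fitting-size k≤2m
...   | s , 2m≤4s+k , room = s , 2m≤4s+k , no-path⇒edgelessPair E? no-path room

corollary2p2 : (m k : ℕ) (E : Fin m → Fin m → Set) → Decidable E →
    ¬ HasPathOfLength E k →
    Σ (Subset m) λ X₁ → Σ (Subset m) λ X₂ →
      (∣ X₁ ∣ ≡ ∣ X₂ ∣) × (4 * ∣ X₁ ∣ + k ≥ m + m) ×
      ((a b : Fin m) → a ∈ X₁ → b ∈ X₂ → ¬ E a b)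
corollary2p2 m k E E? no-path with no-path⇒large-edgelessPair E? no-path
... | s , 2m≤4s+k , X₁ , X₂ , ∣X₁∣≡s , ∣X₂∣≡s , no-edge =
  X₁ , X₂ , trans ∣X₁∣≡s (sym ∣X₂∣≡s) , subst (λ t → 4 * t + k ≥ m + m) (sym ∣X₁∣≡s) 2m≤4s+k , no-edge
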